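{- Let $\kappa \in \{2,3,4,\ldots,\omega,\omega_1\}$. If a function $g\colon \mathbb{N} \to \mathbb{N}$ has a $\kappa$-fold Diophantine representation, then $g(n) < h_{\kappa}(n)$ for every sufficiently large integer $n$.
   Context: $\mathbb{N}$ denotes the set of non-negative integers; $\omega$ is the least infinite cardinal and $\omega_1$ the least uncountable cardinal. A set $\mathcal{M} \subseteq \mathbb{N}^p$ has a $\kappa$-fold Diophantine representation if there is a polynomial $W$ with integer coefficients such that for all $(a_1,\ldots,a_p)\in\mathbb{N}^p$: $(a_1,\ldots,a_p) \in \mathcal{M}$ iff there exist $x_1,\ldots,x_m \in \mathbb{N}$ with $W(a_1,\ldots,a_p,x_1,\ldots,x_m)=0$, and moreover for all $a_1,\ldots,a_p \in \mathbb{N}$ the equation $W(a_1,\ldots,a_p,x_1,\ldots,x_m)=0$ has fewer than $\kappa$ solutions $(x_1,\ldots,x_m)\in\mathbb{N}^m$. A function $g\colon\mathbb{N}\to\mathbb{N}$ has a $\kappa$-fold Diophantine representation if its graph $\{(x,g(x))\colon x\in\mathbb{N}\}\subseteq\mathbb{N}^2$ does. For a positive integer $n$, let $B(\kappa,n)$ be the set of all polynomials $D(x,x_1,\ldots,x_i)$ with integer coefficients such that: the total degree of $D$ is at most $n$; every coefficient of $D$ lies in $[-n,n]$; $i \leq n$; for each non-negative integer $j$ the equation $D(j,x_1,\ldots,x_i)=0$ is solvable in non-negative integers $x_1,\ldots,x_i$; and for each non-negative integer $j$ the equation $D(j,x_1,\ldots,x_i)=0$ has fewer than $\kappa$ solutions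 in non-negative integers $x_1,\ldots,x_i$. Then $h_\kappa(n)$ denotes the smallest non-negative integer $b$ such that for each polynomial $D(x,x_1,\ldots,x_i) \in B(\kappa,n)$ the equation $D(n,x_1,\ldots,x_i)=0$ has a solution in non-negative integers $x_1,\ldots,x_i$ all not greater than $b$. -}

module Defs where

open import Data.Nat as ℕ using (ℕ; zero; suc; _≤_; _<_)
open import Data.Integer as ℤ using (ℤ; +_; -_)
open import Data.List using (List; []; _∷_; map; concatMap; upTo; foldr; length)
open import Data.List.Relation.Unary.All using (All)
open import Data.List.Relation.Unary.Unique.Propositional using (Unique)
open import Data.List.Membership.Propositional using (_∈_)
open import Data.Vec using (Vec; []; _∷_)
import Data.Vec as Vec
open import Data.Vec.Relation.Unary.All using () renaming (All to VAll)
open import Data.Product using (Σ; ∃; ∃-syntax; _×_; _,_)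
open import Function.Definitions using (Injective)
open import Relation.Binary.PropositionalEquality using (_≡_)
open import Relation.Nullary using (¬_)

vsum : ∀ {k} → Vec ℕ k → ℕ
vsum = Vec.foldr _ ℕ._+_ 0

-- Polynomials in k variables with integer coefficients, given by their
-- (canonical) coefficient function on exponent vectors, with finite support:
-- every monomial with nonzero coefficient has degree ≤ bound.
record Poly (k : ℕ) : Set where
  field
    bound : ℕ
    coef  : Vec ℕ k → ℤ
    supp  : ∀ e → ¬ (coef e ≡ + 0) → vsum e ≤ bound
open Poly public

allVecs : (k d : ℕ) → List (Vec ℕ k)
allVecs zero    d = [] ∷ []
allVecs (suc k) d = concatMap (λ v → map (λ a → a ∷ v) (upTo (suc d))) (allVecs k d)

monomial : ∀ {k} → Vec ℕ k → Vec ℕ k → ℤ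
monomial []       []       = + 1
monomial (e ∷ es) (x ∷ xs) = (+ x) ℤ.^ e ℤ.* monomial es xs

eval : ∀ {k} → Poly k → Vec ℕ k → ℤ
eval p xs = foldr ℤ._+_ (+ 0)
  (map (λ e → coef p e ℤ.* monomial e xs) (allVecs _ (bound p)))

DegreeAtMost : ∀ {k} → ℕ → Poly k → Set
DegreeAtMost n p = ∀ e → ¬ (coef p e ≡ + 0) → vsum e ≤ n

CoefsBounded : ∀ {k} → ℕ → Poly k → Set
CoefsBounded n p = ∀ e → (- (+ n)) ℤ.≤ coef p e × coef p e ℤ.≤ + n

data Card : Set where
  fin    : (k : ℕ) → 2 ≤ k → Card
  omega  : Card
  omega1 : Card

FewerThan : ∀ {m} → Card → (Vec ℕ m → Set) → Set
FewerThan {m} (fin k _) S =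
  ¬ (Σ (List (Vec ℕ m)) λ L → length L ≡ k × Unique L × All S L)
FewerThan {m} omega S =
  Σ (List (Vec ℕ m)) λ L → ∀ x → S x → x ∈ L
FewerThan {m} omega1 S =
  Σ (Σ (Vec ℕ m) S → ℕ) λ f → Injective _≡_ _≡_ f

HasRep : Card → (ℕ → ℕ) → Set
HasRep κ g = Σ ℕ λ m → Σ (Poly (2 ℕ.+ m)) λ W →
  ∀ a b →
    ((b ≡ g a → ∃[ xs ] eval W (a ∷ b ∷ xs) ≡ + 0)
      × ((∃[ xs ] eval W (a ∷ b ∷ xs) ≡ + 0) → b ≡ g a))
    × FewerThan κ (λ xs → eval W (a ∷ b ∷ xs) ≡ + 0)

-- D(x, x₁,…,xᵢ) ∈ B(κ,n)   (i ≤ n is imposed separately).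
InB : Card → (n : ℕ) → ∀ {i} → Poly (suc i) → Set
InB κ n D =
  DegreeAtMost n D × CoefsBounded n D
  × (∀ j → ∃[ xs ] eval D (j ∷ xs) ≡ + 0)
  × (∀ j → FewerThan κ (λ xs → eval D (j ∷ xs) ≡ + 0))

-- b has the defining property of h_κ(n) (not necessarily least).
HBound : Card → ℕ → ℕ → Set
HBound κ n b = ∀ i → i ≤ n → (D : Poly (suc i)) → InB κ n D →
  ∃[ xs ] (eval D (n ∷ xs) ≡ + 0 × VAll (λ x → x ≤ b) xs)

IsH : Card → ℕ → ℕ → Set
IsH κ n b = HBound κ n b × (∀ b′ → HBound κ n b′ → b ≤ b′)

-- If W(a, b, x̄) = 0 represents the graph of g with fewer than κ solutions
-- x̄ for every (a, b), then D(x, y, u, x̄) = W(x, u, x̄)² + (u + 1 − y)² has,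
-- for every j, the solutions (g j + 1, g j, x̄) with W(j, g j, x̄) = 0 and no
-- others.  So D is solvable at every j with fewer than κ solutions, and once
-- n bounds its number of variables, its degree and its coefficients, D lies
-- in B(κ, n).  Hence h_κ(n) bounds the y of some solution at n, i.e. g n + 1.
module Submission where

open import Defs
open import Data.Nat using (ℕ; _≤_; _<_)
open import Data.Product using (Σ)

open import Axiom.UniquenessOfIdentityProofs using (module Decidable⇒UIP)
open import Data.Bool using (if_then_else_)
open import Data.Empty using (⊥-elim)
open import Data.Integer as ℤ using (ℤ; +_; -[1+_]; ∣_∣; 0ℤ; 1ℤ; -1ℤ; _+_; _-_; _*_)
import Data.Integer.Properties as ℤP
open import Data.Integer.Solver using (module +-*-Solver)
open import Data.List using (List; []; _∷_; map; concatMap; upTo; applyUpTo; foldr; _++_)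
import Data.List.Properties as LP
open import Data.List.Membership.Propositional using (_∈_)
open import Data.List.Membership.Propositional.Properties using (∈-map⁺)
open import Data.List.Relation.Unary.All as All using (All; []; _∷_)
import Data.List.Relation.Unary.All.Properties as AllP
open import Data.List.Relation.Unary.AllPairs using ([]; _∷_)
open import Data.List.Relation.Unary.Unique.Propositional using (Unique)
open import Data.Nat as ℕ using (zero; suc; z≤n; s≤s; _⊔_)
import Data.Nat.Properties as ℕP
open import Data.Product using (_×_; _,_; proj₁; proj₂; ∃-syntax)
open import Data.Sign.Properties using (s*s≡+)
open import Data.Sum using ([_,_]′)
open import Data.Vec as V using (Vec; []; _∷_)
import Data.Vec.Properties as VP
open import Data.Vec.Relation.Unary.All using () renaming (All to VAll; _∷_ to _∷ᵥ_)
open import Function using (id; _∘_)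
open import Relation.Binary.PropositionalEquality
open import Relation.Nullary using (Dec; does; yes; no)

open import Algebra.Properties.CommutativeSemigroup ℤP.+-commutativeSemigroup
  using () renaming (interchange to +-interchange)
open import Algebra.Properties.CommutativeSemigroup ℤP.*-commutativeSemigroup
  using () renaming (interchange to *-interchange)

private variable
  A B : Set

sumBy : (A → ℤ) → List A → ℤ
sumBy F xs = foldr _+_ 0ℤ (map F xs)

sumBy-++ : ∀ (F : A → ℤ) xs ys → sumBy F (xs ++ ys) ≡ sumBy F xs + sumBy F ys
sumBy-++ F []       ys = sym (ℤP.+-identityˡ _)
sumBy-++ F (x ∷ xs) ys =
  trans (cong (_+_ (F x)) (sumBy-++ F xs ys)) (sym (ℤP.+-assoc (F x) _ _))

sumBy-map : ∀ (F : B → ℤ) (f : A → B) xs → sumBy F (map f xs) ≡ sumBy (F ∘ f) xs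
sumBy-map F f []       = refl
sumBy-map F f (x ∷ xs) = cong (_+_ (F (f x))) (sumBy-map F f xs)

sumBy-concatMap : ∀ (F : B → ℤ) (f : A → List B) xs →
                  sumBy F (concatMap f xs) ≡ sumBy (sumBy F ∘ f) xs
sumBy-concatMap F f []       = refl
sumBy-concatMap F f (x ∷ xs) =
  trans (sumBy-++ F (f x) (concatMap f xs)) (cong (_+_ (sumBy F (f x))) (sumBy-concatMap F f xs))

sumBy-cong : ∀ {F G : A → ℤ} → (∀ a → F a ≡ G a) → ∀ xs → sumBy F xs ≡ sumBy G xs
sumBy-cong F≗G []       = refl
sumBy-cong F≗G (x ∷ xs) = cong₂ _+_ (F≗G x) (sumBy-cong F≗G xs)

sumBy-+ : ∀ (F G : A → ℤ) xs → sumBy (λ a → F a + G a) xs ≡ sumBy F xs + sumBy G xs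
sumBy-+ F G []       = refl
sumBy-+ F G (x ∷ xs) =
  trans (cong (_+_ (F x + G x)) (sumBy-+ F G xs)) (+-interchange (F x) (G x) _ _)

sumBy-*ʳ : ∀ (F : A → ℤ) c xs → sumBy (λ a → F a * c) xs ≡ sumBy F xs * c
sumBy-*ʳ F c []       = sym (ℤP.*-zeroˡ c)
sumBy-*ʳ F c (x ∷ xs) =
  trans (cong (_+_ (F x * c)) (sumBy-*ʳ F c xs)) (sym (ℤP.*-distribʳ-+ c (F x) _))

sumBy-*ˡ : ∀ c (F : A → ℤ) xs → sumBy (λ a → c * F a) xs ≡ c * sumBy F xs
sumBy-*ˡ c F xs = begin
  sumBy (λ a → c * F a) xs ≡⟨ sumBy-cong (λ a → ℤP.*-comm c (F a)) xs ⟩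
  sumBy (λ a → F a * c) xs ≡⟨ sumBy-*ʳ F c xs ⟩
  sumBy F xs * c           ≡⟨ ℤP.*-comm _ c ⟩
  c * sumBy F xs           ∎
  where open ≡-Reasoning

sumBy-zero : ∀ {F : A → ℤ} {xs} → All (λ a → F a ≡ 0ℤ) xs → sumBy F xs ≡ 0ℤ
sumBy-zero []           = refl
sumBy-zero (Fx≡0 ∷ all) = cong₂ _+_ Fx≡0 (sumBy-zero all)

sumBy-applyUpTo-single : ∀ (F : A → ℤ) (f : ℕ → A) {n i} → i < n →
                         (∀ j → j ≢ i → F (f j) ≡ 0ℤ) → sumBy F (applyUpTo f n) ≡ F (f i)
sumBy-applyUpTo-single F f {suc n} {zero} _ off =
  trans (cong (_+_ (F (f 0))) (sumBy-zero (AllP.applyUpTo⁺₂ (f ∘ suc) n (λ j → off (suc j) λ ()))))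
        (ℤP.+-identityʳ _)
sumBy-applyUpTo-single F f {suc n} {suc i} (s≤s i<n) off =
  trans (cong (_+ sumBy F (applyUpTo (f ∘ suc) n)) (off 0 λ ()))
        (trans (ℤP.+-identityˡ _)
               (sumBy-applyUpTo-single F (f ∘ suc) i<n
                  (λ j j≢i → off (suc j) (j≢i ∘ ℕP.suc-injective))))

-- allVecs k d lists every exponent vector of degree ≤ d exactly once.
sumBy-allVecs-single : ∀ {k d} (F : Vec ℕ k → ℤ) {e} → vsum e ≤ d →
                       (∀ e′ → e′ ≢ e → F e′ ≡ 0ℤ) → sumBy F (allVecs k d) ≡ F e
sumBy-allVecs-single {zero}      F {[]}    _    _   = ℤP.+-identityʳ _
sumBy-allVecs-single {suc k} {d} F {a ∷ e} a+e≤d off = begin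
  sumBy F (concatMap row (allVecs k d))
    ≡⟨ sumBy-concatMap F row (allVecs k d) ⟩
  sumBy (sumBy F ∘ row) (allVecs k d)
    ≡⟨ sumBy-cong sumBy-row (allVecs k d) ⟩
  sumBy rowSum (allVecs k d)
    ≡⟨ sumBy-allVecs-single rowSum (ℕP.m+n≤o⇒n≤o a a+e≤d)
         (λ v v≢e → sumBy-zero {F = F} (AllP.applyUpTo⁺₂ (_∷ v) (suc d)
                      (λ b → off (b ∷ v) (v≢e ∘ VP.∷-injectiveʳ)))) ⟩
  rowSum e
    ≡⟨ sumBy-applyUpTo-single F (_∷ e) (s≤s (ℕP.m+n≤o⇒m≤o a a+e≤d))
         (λ b b≢a → off (b ∷ e) (b≢a ∘ VP.∷-injectiveˡ)) ⟩
  F (a ∷ e)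
    ∎
  where
  open ≡-Reasoning
  row : Vec ℕ k → List (Vec ℕ (suc k))
  row v = map (λ b → b ∷ v) (upTo (suc d))
  rowSum : Vec ℕ k → ℤ
  rowSum v = sumBy F (applyUpTo (_∷ v) (suc d))
  sumBy-row : ∀ v → sumBy F (row v) ≡ rowSum v
  sumBy-row v = cong (sumBy F) (LP.map-upTo (_∷ v) (suc d))

monomial-+ : ∀ {k} (e e′ xs : Vec ℕ k) →
             monomial (V.zipWith ℕ._+_ e e′) xs ≡ monomial e xs * monomial e′ xs
monomial-+ []      []       []       = refl
monomial-+ (a ∷ e) (b ∷ e′) (x ∷ xs) =
  trans (cong₂ _*_ (ℤP.^-distribˡ-+-* (+ x) a b) (monomial-+ e e′ xs))
        (*-interchange ((+ x) ℤ.^ a) ((+ x) ℤ.^ b) (monomial e xs) (monomial e′ xs))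

monomial-replicate-0 : ∀ {k} (xs : Vec ℕ k) → monomial (V.replicate k 0) xs ≡ 1ℤ
monomial-replicate-0 []       = refl
monomial-replicate-0 (x ∷ xs) = cong (1ℤ *_) (monomial-replicate-0 xs)

-- Polynomials presented by a list of (coefficient, exponent) terms, with repetitions allowed.
Term : ℕ → Set
Term k = ℤ × Vec ℕ k

module _ {k : ℕ} where

  evalTerm : Vec ℕ k → Term k → ℤ
  evalTerm xs (c , e) = c * monomial e xs

  evalTerms : List (Term k) → Vec ℕ k → ℤ
  evalTerms ts xs = sumBy (evalTerm xs) ts

  _≟ᵥ_ : (e e′ : Vec ℕ k) → Dec (e ≡ e′)
  _≟ᵥ_ = VP.≡-dec ℕP._≟_

  coefAt : Vec ℕ k → Term k → ℤ
  coefAt e (c , e′) = if does (e ≟ᵥ e′) then c else 0ℤ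

  coefAt-self : ∀ c e → coefAt e (c , e) ≡ c
  coefAt-self c e with e ≟ᵥ e
  ... | yes _   = refl
  ... | no e≢e = ⊥-elim (e≢e refl)

  coefAt-other : ∀ c {e e′} → e ≢ e′ → coefAt e (c , e′) ≡ 0ℤ
  coefAt-other c {e} {e′} e≢e′ with e ≟ᵥ e′
  ... | yes e≡e′ = ⊥-elim (e≢e′ e≡e′)
  ... | no _     = refl

  ∣coefAt∣≤∣coef∣ : ∀ c e e′ → ∣ coefAt e (c , e′) ∣ ≤ ∣ c ∣
  ∣coefAt∣≤∣coef∣ c e e′ with e ≟ᵥ e′
  ... | yes _ = ℕP.≤-refl
  ... | no _  = z≤n

  coefTerms : List (Term k) → Vec ℕ k → ℤ
  coefTerms ts e = sumBy (coefAt e) ts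

  maxDegree : List (Term k) → ℕ
  maxDegree []            = 0
  maxDegree ((_ , e) ∷ ts) = vsum e ⊔ maxDegree ts

  coefAbsSum : List (Term k) → ℕ
  coefAbsSum []            = 0
  coefAbsSum ((c , _) ∷ ts) = ∣ c ∣ ℕ.+ coefAbsSum ts

  coefTerms-supp : ∀ ts e → coefTerms ts e ≢ 0ℤ → vsum e ≤ maxDegree ts
  coefTerms-supp []              e ≢0 = ⊥-elim (≢0 refl)
  coefTerms-supp ((c , e′) ∷ ts) e ≢0 with e ≟ᵥ e′
  ... | yes refl = ℕP.m≤m⊔n (vsum e) (maxDegree ts)
  ... | no e≢e′  = ℕP.≤-trans (coefTerms-supp ts e (≢0 ∘ cong (_+_ 0ℤ)))
                              (ℕP.m≤n⊔m (vsum e′) (maxDegree ts))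

  ∣coefTerms∣≤coefAbsSum : ∀ ts e → ∣ coefTerms ts e ∣ ≤ coefAbsSum ts
  ∣coefTerms∣≤coefAbsSum []              e = z≤n
  ∣coefTerms∣≤coefAbsSum ((c , e′) ∷ ts) e =
    ℕP.≤-trans (ℤP.∣i+j∣≤∣i∣+∣j∣ (coefAt e (c , e′)) (coefTerms ts e))
               (ℕP.+-mono-≤ (∣coefAt∣≤∣coef∣ c e e′) (∣coefTerms∣≤coefAbsSum ts e))

  fromTerms : List (Term k) → Poly k
  fromTerms ts = record { bound = maxDegree ts ; coef = coefTerms ts ; supp = coefTerms-supp ts }

  sumBy-allVecs-coefTerms : ∀ {d} ts xs → maxDegree ts ≤ d →
    sumBy (λ e → coefTerms ts e * monomial e xs) (allVecs k d) ≡ evalTerms ts xs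
  sumBy-allVecs-coefTerms {d} [] xs _ =
    sumBy-zero (All.universal (λ e → ℤP.*-zeroˡ (monomial e xs)) (allVecs k d))
  sumBy-allVecs-coefTerms {d} ((c , e′) ∷ ts) xs deg≤d = begin
    sumBy (λ e → (coefAt e (c , e′) + coefTerms ts e) * monomial e xs) (allVecs k d)
      ≡⟨ sumBy-cong (λ e → ℤP.*-distribʳ-+ (monomial e xs) (coefAt e (c , e′)) (coefTerms ts e))
                    (allVecs k d) ⟩
    sumBy (λ e → coefAt e (c , e′) * monomial e xs + coefTerms ts e * monomial e xs) (allVecs k d)
      ≡⟨ sumBy-+ _ _ (allVecs k d) ⟩
    sumBy (λ e → coefAt e (c , e′) * monomial e xs) (allVecs k d)
      + sumBy (λ e → coefTerms ts e * monomial e xs) (allVecs k d)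
      ≡⟨ cong₂ _+_
           (sumBy-allVecs-single (λ e → coefAt e (c , e′) * monomial e xs)
              (ℕP.m⊔n≤o⇒m≤o (vsum e′) _ deg≤d)
              (λ e e≢e′ → trans (cong (_* monomial e xs) (coefAt-other c e≢e′))
                                (ℤP.*-zeroˡ (monomial e xs))))
           (sumBy-allVecs-coefTerms ts xs (ℕP.m⊔n≤o⇒n≤o (vsum e′) _ deg≤d)) ⟩
    coefAt e′ (c , e′) * monomial e′ xs + evalTerms ts xs
      ≡⟨ cong (λ c′ → c′ * monomial e′ xs + evalTerms ts xs) (coefAt-self c e′) ⟩
    c * monomial e′ xs + evalTerms ts xs
      ∎
    where open ≡-Reasoning

  eval-fromTerms : ∀ ts xs → eval (fromTerms ts) xs ≡ evalTerms ts xs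
  eval-fromTerms ts xs = sumBy-allVecs-coefTerms ts xs ℕP.≤-refl

  degreeAtMost-fromTerms : ∀ {n} ts → maxDegree ts ≤ n → DegreeAtMost n (fromTerms ts)
  degreeAtMost-fromTerms ts deg≤n e ≢0 = ℕP.≤-trans (coefTerms-supp ts e ≢0) deg≤n

  coefsBounded-fromTerms : ∀ {n} ts → coefAbsSum ts ≤ n → CoefsBounded n (fromTerms ts)
  coefsBounded-fromTerms ts sum≤n e =
    ∣i∣≤n⇒-n≤i≤n (ℕP.≤-trans (∣coefTerms∣≤coefAbsSum ts e) sum≤n)
    where
    ∣i∣≤n⇒-n≤i≤n : ∀ {n i} → ∣ i ∣ ≤ n → ℤ.- (+ n) ℤ.≤ i × i ℤ.≤ + n
    ∣i∣≤n⇒-n≤i≤n {n}     {+ _}     ∣i∣≤n     = ℤP.neg-≤-pos , ℤ.+≤+ ∣i∣≤n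
    ∣i∣≤n⇒-n≤i≤n {suc n} { -[1+ _ ]} (s≤s ≤n) = ℤ.-≤- ≤n , ℤ.-≤+

  _·ᵀ_ : Term k → Term k → Term k
  (c , e) ·ᵀ (c′ , e′) = c * c′ , V.zipWith ℕ._+_ e e′

  _*ᵀ_ : List (Term k) → List (Term k) → List (Term k)
  ts *ᵀ us = concatMap (λ t → map (t ·ᵀ_) us) ts

  evalTerm-· : ∀ xs t u → evalTerm xs (t ·ᵀ u) ≡ evalTerm xs t * evalTerm xs u
  evalTerm-· xs (c , e) (c′ , e′) =
    trans (cong (c * c′ *_) (monomial-+ e e′ xs)) (*-interchange c c′ (monomial e xs) (monomial e′ xs))

  evalTerms-* : ∀ ts us xs → evalTerms (ts *ᵀ us) xs ≡ evalTerms ts xs * evalTerms us xs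
  evalTerms-* ts us xs = begin
    evalTerms (ts *ᵀ us) xs                             ≡⟨ sumBy-concatMap _ _ ts ⟩
    sumBy (λ t → sumBy (evalTerm xs) (map (t ·ᵀ_) us)) ts ≡⟨ sumBy-cong row ts ⟩
    sumBy (λ t → evalTerm xs t * evalTerms us xs) ts     ≡⟨ sumBy-*ʳ _ _ ts ⟩
    evalTerms ts xs * evalTerms us xs                   ∎
    where
    open ≡-Reasoning
    row : ∀ t → sumBy (evalTerm xs) (map (t ·ᵀ_) us) ≡ evalTerm xs t * evalTerms us xs
    row t = trans (sumBy-map _ _ us)
                  (trans (sumBy-cong (evalTerm-· xs t) us) (sumBy-*ˡ (evalTerm xs t) _ us))

module _ {a b : ℕ} {S : Vec ℕ a → Set} {T : Vec ℕ b → Set} where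

  -- Proof irrelevance of S is needed only for κ = ω₁.
  fewerThan-embed : (φ : Vec ℕ a → Vec ℕ b) (ψ : Vec ℕ b → Vec ℕ a) →
                    (∀ {v} → S v → T (φ v)) → (∀ {v} → S v → ψ (φ v) ≡ v) →
                    (∀ {v} (s t : S v) → s ≡ t) →
                    ∀ κ → FewerThan κ T → FewerThan κ S
  fewerThan-embed φ ψ S⇒T ψφ≡id irr = λ where
      (fin k _) noList (L , len≡k , unique , allS) →
        noList ( map φ L , trans (LP.length-map φ L) len≡k , map-unique unique allS
               , AllP.map⁺ (All.map S⇒T allS))
      omega (L , covers) →
        map ψ L , λ v s → subst (_∈ map ψ L) (ψφ≡id s) (∈-map⁺ ψ (covers (φ v) (S⇒T s)))
      omega1 (f , f-inj) → (λ (v , s) → f (φ v , S⇒T s)) , λ eq → pair-injective (f-inj eq)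
    where
    φ-injective : ∀ {v w} → S v → S w → φ v ≡ φ w → v ≡ w
    φ-injective {v} {w} s t eq = trans (sym (ψφ≡id s)) (trans (cong ψ eq) (ψφ≡id t))

    map-unique : ∀ {L} → Unique L → All S L → Unique (map φ L)
    map-unique []                     []       = []
    map-unique (v∉L ∷ unique) (s ∷ allS) =
      AllP.map⁺ (All.zipWith (λ (v≢w , t) → v≢w ∘ φ-injective s t) (v∉L , allS))
      ∷ map-unique unique allS

    pair-injective : ∀ {p q : Σ (Vec ℕ a) S} →
                     (φ (proj₁ p) , S⇒T (proj₂ p)) ≡ (φ (proj₁ q) , S⇒T (proj₂ q)) → p ≡ q
    pair-injective {v , s} {w , t} eq with φ-injective s t (cong proj₁ eq)
    ... | refl = cong (v ,_) (irr s t)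

i*i≡+∣i∣*∣i∣ : ∀ i → i * i ≡ + (∣ i ∣ ℕ.* ∣ i ∣)
i*i≡+∣i∣*∣i∣ i rewrite s*s≡+ (ℤ.sign i) = ℤP.+◃n≡+n _

i*i+j*j≡0⇒i≡0×j≡0 : ∀ i j → i * i + j * j ≡ 0ℤ → i ≡ 0ℤ × j ≡ 0ℤ
i*i+j*j≡0⇒i≡0×j≡0 i j eq =
  square≡0⇒≡0 i (ℕP.m+n≡0⇒m≡0 _ sum≡0) , square≡0⇒≡0 j (ℕP.m+n≡0⇒n≡0 _ sum≡0)
  where
  sum≡0 : ∣ i ∣ ℕ.* ∣ i ∣ ℕ.+ ∣ j ∣ ℕ.* ∣ j ∣ ≡ 0
  sum≡0 = ℤP.+-injective (trans (sym (cong₂ _+_ (i*i≡+∣i∣*∣i∣ i) (i*i≡+∣i∣*∣i∣ j))) eq)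
  square≡0⇒≡0 : ∀ k → ∣ k ∣ ℕ.* ∣ k ∣ ≡ 0 → k ≡ 0ℤ
  square≡0⇒≡0 k sq≡0 =
    [ id , id ]′ (ℤP.i*j≡0⇒i≡0∨j≡0 k (trans (i*i≡+∣i∣*∣i∣ k) (cong +_ sq≡0)))

module GraphPolynomial {m : ℕ} (W : Poly (2 ℕ.+ m)) where

  insertY : Vec ℕ (2 ℕ.+ m) → Vec ℕ (3 ℕ.+ m)
  insertY (a ∷ b ∷ e) = a ∷ 0 ∷ b ∷ e

  termsW : List (Term (3 ℕ.+ m))
  termsW = map (λ e → coef W e , insertY e) (allVecs (2 ℕ.+ m) (bound W))

  evalTerms-termsW : ∀ x y u xs → evalTerms termsW (x ∷ y ∷ u ∷ xs) ≡ eval W (x ∷ u ∷ xs)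
  evalTerms-termsW x y u xs =
    trans (sumBy-map _ _ (allVecs (2 ℕ.+ m) (bound W)))
          (sumBy-cong (λ { (a ∷ b ∷ e) →
                             cong (λ r → coef W (a ∷ b ∷ e) * ((+ x) ℤ.^ a * r)) (ℤP.*-identityˡ _) })
                      (allVecs (2 ℕ.+ m) (bound W)))

  termsSucMinusY : List (Term (3 ℕ.+ m))
  termsSucMinusY = (1ℤ , 0 ∷ 0 ∷ 1 ∷ zeros) ∷ (1ℤ , 0 ∷ 0 ∷ 0 ∷ zeros)
                 ∷ (-1ℤ , 0 ∷ 1 ∷ 0 ∷ zeros) ∷ []
    where zeros = V.replicate m 0

  evalTerms-termsSucMinusY : ∀ x y u xs → evalTerms termsSucMinusY (x ∷ y ∷ u ∷ xs) ≡ + suc u - + y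
  evalTerms-termsSucMinusY x y u xs rewrite monomial-replicate-0 xs =
    solve 2 (λ U Y → con 1ℤ :* (con 1ℤ :* (con 1ℤ :* ((U :* con 1ℤ) :* con 1ℤ)))
                     :+ (con 1ℤ :* (con 1ℤ :* (con 1ℤ :* (con 1ℤ :* con 1ℤ)))
                     :+ (con -1ℤ :* (con 1ℤ :* ((Y :* con 1ℤ) :* (con 1ℤ :* con 1ℤ))) :+ con 0ℤ))
                 := (con 1ℤ :+ U) :- Y) refl (+ u) (+ y)
    where
    open +-*-Solver

  termsD : List (Term (3 ℕ.+ m))
  termsD = termsW *ᵀ termsW ++ termsSucMinusY *ᵀ termsSucMinusY

  D : Poly (3 ℕ.+ m)
  D = fromTerms termsD

  eval-D : ∀ x y u xs → eval D (x ∷ y ∷ u ∷ xs) ≡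
           eval W (x ∷ u ∷ xs) * eval W (x ∷ u ∷ xs) + (+ suc u - + y) * (+ suc u - + y)
  eval-D x y u xs = begin
    eval D v                                          ≡⟨ eval-fromTerms termsD v ⟩
    evalTerms termsD v                                ≡⟨ sumBy-++ _ (termsW *ᵀ termsW) _ ⟩
    evalTerms (termsW *ᵀ termsW) v + evalTerms (termsSucMinusY *ᵀ termsSucMinusY) v
      ≡⟨ cong₂ _+_ (evalTerms-* termsW termsW v) (evalTerms-* termsSucMinusY termsSucMinusY v) ⟩
    evalTerms termsW v * evalTerms termsW v + evalTerms termsSucMinusY v * evalTerms termsSucMinusY v
      ≡⟨ cong₂ _+_ (cong₂ _*_ (evalTerms-termsW x y u xs) (evalTerms-termsW x y u xs))
                   (cong₂ _*_ (evalTerms-termsSucMinusY x y u xs) (evalTerms-termsSucMinusY x y u xs)) ⟩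
    eval W (x ∷ u ∷ xs) * eval W (x ∷ u ∷ xs) + (+ suc u - + y) * (+ suc u - + y)
      ∎
    where
    open ≡-Reasoning
    v = x ∷ y ∷ u ∷ xs

  D-root⇒W-root : ∀ {x y u xs} → eval D (x ∷ y ∷ u ∷ xs) ≡ 0ℤ →
                  y ≡ suc u × eval W (x ∷ u ∷ xs) ≡ 0ℤ
  D-root⇒W-root {x} {y} {u} {xs} root =
    sym (ℤP.+-injective (ℤP.i-j≡0⇒i≡j (+ suc u) (+ y) (proj₂ squares≡0))) , proj₁ squares≡0
    where
    squares≡0 : eval W (x ∷ u ∷ xs) ≡ 0ℤ × + suc u - + y ≡ 0ℤ
    squares≡0 = i*i+j*j≡0⇒i≡0×j≡0 (eval W (x ∷ u ∷ xs)) (+ suc u - + y)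
                                  (trans (sym (eval-D x y u xs)) root)

  W-root⇒D-root : ∀ {x u xs} → eval W (x ∷ u ∷ xs) ≡ 0ℤ → eval D (x ∷ suc u ∷ u ∷ xs) ≡ 0ℤ
  W-root⇒D-root {x} {u} {xs} W-root =
    trans (eval-D x (suc u) u xs) (cong₂ (λ w d → w * w + d * d) W-root (ℤP.+-inverseʳ (+ suc u)))

  size : ℕ
  size = 2 ℕ.+ m ⊔ maxDegree termsD ⊔ coefAbsSum termsD

  vars≤size : 2 ℕ.+ m ≤ size
  vars≤size = ℕP.≤-trans (ℕP.m≤m⊔n (2 ℕ.+ m) (maxDegree termsD)) (ℕP.m≤m⊔n _ (coefAbsSum termsD))

  degree≤size : maxDegree termsD ≤ size
  degree≤size = ℕP.≤-trans (ℕP.m≤n⊔m (2 ℕ.+ m) (maxDegree termsD)) (ℕP.m≤m⊔n _ (coefAbsSum termsD))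

  coefs≤size : coefAbsSum termsD ≤ size
  coefs≤size = ℕP.m≤n⊔m (2 ℕ.+ m ⊔ maxDegree termsD) (coefAbsSum termsD)

  module _ {g : ℕ → ℕ} (graph : ∀ {a b xs} → eval W (a ∷ b ∷ xs) ≡ 0ℤ → b ≡ g a) where

    D-root⇒onGraph : ∀ {j y u xs} → eval D (j ∷ y ∷ u ∷ xs) ≡ 0ℤ →
                     y ≡ suc (g j) × u ≡ g j × eval W (j ∷ g j ∷ xs) ≡ 0ℤ
    D-root⇒onGraph {j} {y} {u} {xs} root =
      trans y≡1+u (cong suc u≡gj) , u≡gj , subst (λ b → eval W (j ∷ b ∷ xs) ≡ 0ℤ) u≡gj W-root
      where
      y≡1+u : y ≡ suc u
      y≡1+u = proj₁ (D-root⇒W-root root)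
      W-root : eval W (j ∷ u ∷ xs) ≡ 0ℤ
      W-root = proj₂ (D-root⇒W-root root)
      u≡gj : u ≡ g j
      u≡gj = graph W-root

    D-solvable : (∀ a → ∃[ xs ] eval W (a ∷ g a ∷ xs) ≡ 0ℤ) → ∀ j → ∃[ v ] eval D (j ∷ v) ≡ 0ℤ
    D-solvable W-solvable j =
      (suc (g j) ∷ g j ∷ proj₁ (W-solvable j)) , W-root⇒D-root (proj₂ (W-solvable j))

    D-fewerThan : ∀ κ j → FewerThan κ (λ xs → eval W (j ∷ g j ∷ xs) ≡ 0ℤ) →
                  FewerThan κ (λ v → eval D (j ∷ v) ≡ 0ℤ)
    D-fewerThan κ j = fewerThan-embed witness (λ xs → suc (g j) ∷ g j ∷ xs) W-root rebuild irrelevant κ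
      where
      witness : Vec ℕ (2 ℕ.+ m) → Vec ℕ m
      witness (_ ∷ _ ∷ xs) = xs

      W-root : ∀ {v} → eval D (j ∷ v) ≡ 0ℤ → eval W (j ∷ g j ∷ witness v) ≡ 0ℤ
      W-root {_ ∷ _ ∷ _} root = proj₂ (proj₂ (D-root⇒onGraph root))

      rebuild : ∀ {v} → eval D (j ∷ v) ≡ 0ℤ → suc (g j) ∷ g j ∷ witness v ≡ v
      rebuild {_ ∷ _ ∷ xs} root =
        sym (cong₂ (λ y u → y ∷ u ∷ xs) (proj₁ (D-root⇒onGraph root))
                                         (proj₁ (proj₂ (D-root⇒onGraph root))))

      irrelevant : ∀ {v} (s t : eval D (j ∷ v) ≡ 0ℤ) → s ≡ t
      irrelevant = Decidable⇒UIP.≡-irrelevant ℤP._≟_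

    D∈B : ∀ κ → (∀ a → ∃[ xs ] eval W (a ∷ g a ∷ xs) ≡ 0ℤ) →
          (∀ j → FewerThan κ (λ xs → eval W (j ∷ g j ∷ xs) ≡ 0ℤ)) →
          ∀ {n} → size ≤ n → InB κ n D
    D∈B κ W-solvable W-fewerThan size≤n =
        degreeAtMost-fromTerms termsD (ℕP.≤-trans degree≤size size≤n)
      , coefsBounded-fromTerms termsD (ℕP.≤-trans coefs≤size size≤n)
      , D-solvable W-solvable
      , λ j → D-fewerThan κ j (W-fewerThan j)

theorem6 : (κ : Card) (g : ℕ → ℕ) → HasRep κ g →
    Σ ℕ λ N → ∀ n → N ≤ n → ∀ h → IsH κ n h → g n < h
theorem6 κ g (m , W , rep) = size , g<h
  where
  open GraphPolynomial W

  graph : ∀ {a b xs} → eval W (a ∷ b ∷ xs) ≡ 0ℤ → b ≡ g a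
  graph {a} {b} {xs} root = proj₂ (proj₁ (rep a b)) (xs , root)

  g<h : ∀ n → size ≤ n → ∀ h → IsH κ n h → g n < h
  g<h n size≤n h (bounds , _) = root⇒g<h (bounds (2 ℕ.+ m) (ℕP.≤-trans vars≤size size≤n) D D∈Bₙ)
    where
    D∈Bₙ : InB κ n D
    D∈Bₙ = D∈B graph κ (λ a → proj₁ (proj₁ (rep a (g a))) refl) (λ j → proj₂ (rep j (g j))) size≤n

    root⇒g<h : ∃[ v ] (eval D (n ∷ v) ≡ 0ℤ × VAll (_≤ h) v) → g n < h
    root⇒g<h ((_ ∷ _ ∷ _) , root , y≤h ∷ᵥ _) = subst (_≤ h) (proj₁ (D-root⇒onGraph graph root)) y≤h
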